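{- For every $n$ and all $v,w\in S_n$: if $v\le w$ in the weak order, then $v\le w$ in the middle order $\mathcal{P}_n$; and if $v\le w$ in $\mathcal{P}_n$, then $v\le w$ in the Bruhat order. That is, the middle order refines the weak order and the Bruhat order refines the middle order.
   Context: Permutations are written in one-line notation. For $w\in S_n$, its inversion sequence is $I(w)=(x_1,\ldots,x_n)$ with $x_i=\#\{j<i : w^{ -1}(j)>w^{ -1}(i)\}$. The middle order $\mathcal{P}_n$ on $S_n$ is defined by $v\le w$ iff $I(v)\le I(w)$ coordinate-wise. The weak order on $S_n$ is the transitive closure of the relations $v<w$ where $w$ is obtained from $v$ by swapping two adjacent entries $v(i)<v(i+1)$. The Bruhat order on $S_n$ is the transitive closure of the relations $v<w$ where $w$ is obtained from $v$ by swapping entries in positions $a<b$ with $v(a)<v(b)$ such that no $c$ with $a<c<b$ has $v(a)<v(c)<v(b)$. -}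

module Defs where

open import Data.Nat using (ℕ; suc) renaming (_≤_ to _≤ℕ_)
open import Data.Fin using (Fin; toℕ; _<_; _<?_)
open import Data.Fin.Properties using (_≟_)
open import Data.Vec using (Vec; lookup; _[_]≔_)
open import Data.List using (List; length; filter; cartesianProduct; allFin)
open import Data.Product using (Σ; _×_; _,_; proj₁; proj₂)
open import Relation.Binary.PropositionalEquality using (_≡_)
open import Relation.Nullary using (¬_)
open import Relation.Nullary.Decidable using (_×-dec_)
open import Relation.Binary.Construct.Closure.ReflexiveTransitive using (Star)

-- A permutation w ∈ S_n in one-line notation: the vector (w(0),…,w(n-1))
-- of values in Fin n (0-indexed), required to be a bijection.
IsPerm : ∀ {n} → Vec (Fin n) n → Set
IsPerm {n} w = ∀ (i : Fin n) → Σ (Fin n) (λ p → lookup w p ≡ i × (∀ q → lookup w q ≡ i → q ≡ p))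

-- Inversion sequence: I(w)_i = #{ j < i : w⁻¹(j) > w⁻¹(i) }.
-- Written out: the number of positions q after the position p of the
-- value i (w p ≡ i, p < q) whose value w q is smaller than i.
invSeq : ∀ {n} → Vec (Fin n) n → Fin n → ℕ
invSeq {n} w i =
  length (filter (λ pq → (lookup w (proj₁ pq) ≟ i)
                         ×-dec ((proj₁ pq <? proj₂ pq) ×-dec (lookup w (proj₂ pq) <? i)))
                 (cartesianProduct (allFin n) (allFin n)))

MiddleLe : ∀ {n} → Vec (Fin n) n → Vec (Fin n) n → Set
MiddleLe {n} v w = ∀ (i : Fin n) → invSeq v i ≤ℕ invSeq w i

swapAt : ∀ {n} → Vec (Fin n) n → Fin n → Fin n → Vec (Fin n) n
swapAt v a b = (v [ a ]≔ lookup v b) [ b ]≔ lookup v a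

WeakStep : ∀ {n} → Vec (Fin n) n → Vec (Fin n) n → Set
WeakStep {n} v w = Σ (Fin n) λ a → Σ (Fin n) λ b →
  (toℕ b ≡ suc (toℕ a)) × (lookup v a < lookup v b) × (w ≡ swapAt v a b)

BruhatStep : ∀ {n} → Vec (Fin n) n → Vec (Fin n) n → Set
BruhatStep {n} v w = Σ (Fin n) λ a → Σ (Fin n) λ b →
  (a < b) × (lookup v a < lookup v b)
  × (∀ (c : Fin n) → a < c → c < b → ¬ ((lookup v a < lookup v c) × (lookup v c < lookup v b)))
  × (w ≡ swapAt v a b)

WeakLe : ∀ {n} → Vec (Fin n) n → Vec (Fin n) n → Set
WeakLe = Star WeakStep

BruhatLe : ∀ {n} → Vec (Fin n) n → Vec (Fin n) n → Set
BruhatLe = Star BruhatStep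

-- Write I(v)(k) as the number of positions after the position of k whose
-- entries are smaller than k.  If v(a) < v(p) with a < p and every entry
-- strictly between them exceeds v(p), swapping positions a and p raises I(v)
-- by exactly one, at the value v(p).  Adjacent ascents are such swaps, which
-- gives weak ≤ ⇒ middle ≤, and each such swap is a Bruhat step.  Conversely, if
-- I(v) ≤ I(w) with I(v)(k) < I(w)(k), then some position before that of k holds
-- a smaller entry (otherwise I(v)(k) would already be maximal), and the closest
-- one yields such a swap that stays below w.  Each swap adds one inversion, so
-- iterating reaches I(v) = I(w), and the inversion sequence of a permutation
-- determines it.

module Submission where

open import Defs
open import Data.Bool using (true; false; if_then_else_)
open import Data.Fin using (Fin; zero; suc; toℕ; _<_; _>_; _<?_; punchIn)
open import Data.Fin.Induction using (>-wellFounded; <-wellFounded)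
open import Data.Fin.Permutation
  using (Permutation; permutation; transpose; _⟨$⟩ʳ_; _⟨$⟩ˡ_; inverseˡ; inverseʳ)
open import Data.Fin.Properties
  using (_≟_; any?; <-cmp; <-irrefl; <-asym; <-trans; <⇒≢; ≤∧≢⇒<; punchInᵢ≢i)
open import Data.List using (_∷_; length; filter; cartesianProduct; allFin; map; _++_; tabulate)
open import Data.List.Properties using (length-++; filter-++; map-tabulate)
open import Data.Nat using (ℕ; zero; suc; _+_; z≤n; s≤s⁻¹) renaming (_≤_ to _≤ℕ_; _<_ to _<ℕ_)
import Data.Nat.Properties as ℕ
open import Data.Nat.Properties
  using (+-*-semiring; +-identityʳ; +-mono-≤; +-comm; +-assoc; +-suc; +-cancelˡ-≡;
         ≤-refl; ≤-trans; <⇒≱; ≮⇒≥; n<1+n; m≤m+n)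
open import Algebra.Properties.Semiring.Sum +-*-semiring
  using (sum; sum-syntax; sum-cong-≗; ∑-distrib-+; ∑-permute; sum-remove; sum-replicate-zero)
open import Data.Product using (_×_; _,_; ∃; proj₁; proj₂)
open import Data.Vec as Vec using (Vec; lookup; _[_]≔_)
open import Data.Vec.Properties using (lookup∘update; lookup∘update′; tabulate∘lookup; tabulate-cong)
open import Function using (_∘_; id)
open import Induction.WellFounded using (Acc; acc)
open import Relation.Binary.Construct.Closure.ReflexiveTransitive using (ε; _◅_)
open import Relation.Binary.Definitions using (tri<; tri≈; tri>)
open import Relation.Binary.PropositionalEquality
open import Relation.Nullary using (Dec; does; yes; no; ¬_; contradiction)
open import Relation.Nullary.Decidable using (_×-dec_; dec-true; dec-false)
open import Relation.Unary using (Pred; Decidable)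
import Data.Fin.Permutation.Components as PC

-- Indicators and finite sums

𝟙 : ∀ {p} {P : Set p} → Dec P → ℕ
𝟙 P? = if does P? then 1 else 0

𝟙-yes : ∀ {p} {P : Set p} (P? : Dec P) → P → 𝟙 P? ≡ 1
𝟙-yes P? x rewrite dec-true P? x = refl

𝟙-no : ∀ {p} {P : Set p} (P? : Dec P) → ¬ P → 𝟙 P? ≡ 0
𝟙-no P? ¬x rewrite dec-false P? ¬x = refl

𝟙-×-yes : ∀ {p q} {P : Set p} {Q : Set q} (P? : Dec P) (Q? : Dec Q) → P → 𝟙 (P? ×-dec Q?) ≡ 𝟙 Q?
𝟙-×-yes P? Q? x rewrite dec-true P? x = refl

𝟙-×-no : ∀ {p q} {P : Set p} {Q : Set q} (P? : Dec P) (Q? : Dec Q) → ¬ P → 𝟙 (P? ×-dec Q?) ≡ 0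
𝟙-×-no P? Q? ¬x rewrite dec-false P? ¬x = refl

𝟙-×-≤ : ∀ {p q} {P : Set p} {Q : Set q} (P? : Dec P) (Q? : Dec Q) → 𝟙 (P? ×-dec Q?) ≤ℕ 𝟙 Q?
𝟙-×-≤ P? Q? with does P?
... | true  = ≤-refl
... | false = z≤n

𝟙-×-mono : ∀ {p q r} {P : Set p} {Q : Set q} {R : Set r} (P? : Dec P) (Q? : Dec Q) (R? : Dec R) →
  (P → Q) → 𝟙 (P? ×-dec R?) ≤ℕ 𝟙 (Q? ×-dec R?)
𝟙-×-mono P? Q? R? P⇒Q with P?
... | no _  = z≤n
... | yes x rewrite dec-true Q? (P⇒Q x) = ≤-refl

∑-zero : ∀ {n} {f : Fin n → ℕ} → (∀ q → f q ≡ 0) → sum f ≡ 0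
∑-zero {n} f≡0 = trans (sum-cong-≗ f≡0) (sum-replicate-zero n)

∑-δ : ∀ {n} (f : Fin n → ℕ) (p : Fin n) → (∀ q → q ≢ p → f q ≡ 0) → sum f ≡ f p
∑-δ {suc n} f p off = begin
  sum f                          ≡⟨ sum-remove {i = p} f ⟩
  f p + sum (f ∘ punchIn p)      ≡⟨ cong (f p +_) (∑-zero (λ j → off _ (punchInᵢ≢i p j))) ⟩
  f p + 0                        ≡⟨ +-identityʳ (f p) ⟩
  f p                            ∎
  where open ≡-Reasoning

∑-single : ∀ {n} (p : Fin n) x → ∑[ q < n ] (if does (q ≟ p) then x else 0) ≡ x
∑-single p x = trans (∑-δ _ p (λ q q≢p → cong (if_then x else 0) (dec-false (q ≟ p) q≢p)))
                     (cong (if_then x else 0) (dec-true (p ≟ p) refl))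

∑-mono-≤ : ∀ {n} {f g : Fin n → ℕ} → (∀ i → f i ≤ℕ g i) → sum f ≤ℕ sum g
∑-mono-≤ {zero}  _   = z≤n
∑-mono-≤ {suc n} f≤g = +-mono-≤ (f≤g zero) (∑-mono-≤ (f≤g ∘ suc))

∑-cong-except : ∀ {n} {f g : Fin n → ℕ} {a b : Fin n} → a ≢ b →
  (∀ q → q ≢ a → q ≢ b → f q ≡ g q) → f a + f b ≡ g a + g b → sum f ≡ sum g
∑-cong-except {n} {f} {g} {a} {b} a≢b agree ends =
  +-cancelˡ-≡ (f a + f b) _ _ (begin
    (f a + f b) + sum f  ≡⟨ cong (_+ sum f) ends ⟩
    (g a + g b) + sum f  ≡⟨ +-assoc (g a) (g b) (sum f) ⟩
    g a + (g b + sum f)  ≡⟨ sym (total g f) ⟩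
    sum (mixed g f)      ≡⟨ sum-cong-≗ mixed-swap ⟩
    sum (mixed f g)      ≡⟨ total f g ⟩
    f a + (f b + sum g)  ≡⟨ sym (+-assoc (f a) (f b) (sum g)) ⟩
    (f a + f b) + sum g  ∎)
  where
  open ≡-Reasoning
  at : Fin n → ℕ → Fin n → ℕ
  at p x q = if does (q ≟ p) then x else 0
  mixed : (Fin n → ℕ) → (Fin n → ℕ) → Fin n → ℕ
  mixed h k q = at a (h a) q + (at b (h b) q + k q)
  total : ∀ h k → sum (mixed h k) ≡ h a + (h b + sum k)
  total h k = trans (∑-distrib-+ (at a (h a)) _)
    (cong₂ _+_ (∑-single a (h a)) (trans (∑-distrib-+ (at b (h b)) k) (cong (_+ sum k) (∑-single b (h b)))))
  mixed-swap : ∀ q → mixed g f q ≡ mixed f g q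
  mixed-swap q with q ≟ a | q ≟ b
  ... | yes refl | yes refl = contradiction refl a≢b
  ... | yes refl | no _     = +-comm (g q) (f q)
  ... | no _     | yes refl = +-comm (g q) (f q)
  ... | no q≢a   | no q≢b   = agree q q≢a q≢b

∑-split : ∀ {n ℓ} {P : Pred (Fin n) ℓ} (P? : Decidable P) (p : Fin n) →
  ∑[ q < n ] 𝟙 (P? q)
    ≡ ∑[ q < n ] 𝟙 ((q <? p) ×-dec P? q) + (𝟙 (P? p) + ∑[ q < n ] 𝟙 ((p <? q) ×-dec P? q))
∑-split {n} P? p = begin
  ∑[ q < n ] 𝟙 (P? q)                          ≡⟨ sum-cong-≗ trichotomy ⟩
  ∑[ q < n ] (before q + (at q + after q))     ≡⟨ ∑-distrib-+ before _ ⟩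
  sum before + ∑[ q < n ] (at q + after q)     ≡⟨ cong (sum before +_) (∑-distrib-+ at after) ⟩
  sum before + (sum at + sum after)            ≡⟨ cong (λ m → sum before + (m + sum after)) sum-at ⟩
  sum before + (𝟙 (P? p) + sum after)          ∎
  where
  open ≡-Reasoning
  before at after : Fin n → ℕ
  before q = 𝟙 ((q <? p) ×-dec P? q)
  at     q = 𝟙 ((q ≟ p) ×-dec P? q)
  after  q = 𝟙 ((p <? q) ×-dec P? q)
  trichotomy : ∀ q → 𝟙 (P? q) ≡ before q + (at q + after q)
  trichotomy q with <-cmp q p
  ... | tri< q<p _ _ rewrite dec-true (q <? p) q<p | dec-false (q ≟ p) (<⇒≢ q<p)
                           | dec-false (p <? q) (<-asym q<p) = sym (+-identityʳ _)
  ... | tri≈ _ refl _ rewrite dec-false (q <? q) (<-irrefl refl) | dec-true (q ≟ q) refl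
                           = sym (+-identityʳ _)
  ... | tri> _ _ p<q rewrite dec-false (q <? p) (<-asym p<q) | dec-false (q ≟ p) (<⇒≢ p<q ∘ sym)
                           | dec-true (p <? q) p<q = refl
  sum-at : sum at ≡ 𝟙 (P? p)
  sum-at = trans (∑-δ at p (λ q → 𝟙-×-no (q ≟ p) (P? q))) (𝟙-×-yes (p ≟ p) (P? p) refl)

length-filter-∷ : ∀ {a ℓ} {A : Set a} {P : Pred A ℓ} (P? : Decidable P) x xs →
  length (filter P? (x ∷ xs)) ≡ 𝟙 (P? x) + length (filter P? xs)
length-filter-∷ P? x xs with does (P? x)
... | true  = refl
... | false = refl

length-filter-++ : ∀ {a ℓ} {A : Set a} {P : Pred A ℓ} (P? : Decidable P) xs ys →
  length (filter P? (xs ++ ys)) ≡ length (filter P? xs) + length (filter P? ys)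
length-filter-++ P? xs ys = trans (cong length (filter-++ P? xs ys)) (length-++ (filter P? xs))

length-filter-tabulate : ∀ {a ℓ} {A : Set a} {P : Pred A ℓ} (P? : Decidable P) {n} (f : Fin n → A) →
  length (filter P? (tabulate f)) ≡ ∑[ i < n ] 𝟙 (P? (f i))
length-filter-tabulate P? {zero}  f = refl
length-filter-tabulate P? {suc n} f =
  trans (length-filter-∷ P? (f zero) _) (cong (𝟙 (P? (f zero)) +_) (length-filter-tabulate P? (f ∘ suc)))

length-filter-cartesianProduct : ∀ {m n ℓ} {P : Pred (Fin m × Fin n) ℓ} (P? : Decidable P) →
  length (filter P? (cartesianProduct (allFin m) (allFin n))) ≡ ∑[ i < m ] ∑[ j < n ] 𝟙 (P? (i , j))
length-filter-cartesianProduct {m} {n} P? = rows id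
  where
  rows : ∀ {k} (f : Fin k → Fin m) →
    length (filter P? (cartesianProduct (tabulate f) (allFin n))) ≡ ∑[ i < k ] ∑[ j < n ] 𝟙 (P? (f i , j))
  rows {zero}  f = refl
  rows {suc k} f = begin
    length (filter P? (map (f zero ,_) (allFin n) ++ cartesianProduct (tabulate (f ∘ suc)) (allFin n)))
      ≡⟨ length-filter-++ P? (map (f zero ,_) (allFin n)) _ ⟩
    length (filter P? (map (f zero ,_) (allFin n))) + _
      ≡⟨ cong₂ _+_ (trans (cong (length ∘ filter P?) (map-tabulate id (f zero ,_)))
                         (length-filter-tabulate P? (f zero ,_)))
                   (rows (f ∘ suc)) ⟩
    _ ∎
    where open ≡-Reasoning

-- Permutations and swaps

module _ {n} (v : Vec (Fin n) n) (v-perm : IsPerm v) where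

  position : Fin n → Fin n
  position k = proj₁ (v-perm k)

  lookup-position : ∀ k → lookup v (position k) ≡ k
  lookup-position k = proj₁ (proj₂ (v-perm k))

  position-unique : ∀ {q k} → lookup v q ≡ k → q ≡ position k
  position-unique {q} {k} = proj₂ (proj₂ (v-perm k)) q

  lookup-injective : ∀ {p q} → lookup v p ≡ lookup v q → p ≡ q
  lookup-injective vp≡vq = trans (position-unique vp≡vq) (sym (position-unique refl))

  toPermutation : Permutation n n
  toPermutation = permutation (lookup v) position lookup-position (λ q → sym (position-unique refl))

  ∑-∘lookup : (f : Fin n → ℕ) → ∑[ q < n ] f (lookup v q) ≡ sum f
  ∑-∘lookup f = sym (∑-permute f toPermutation)

IsPerm-rearrange : ∀ {n} {u v : Vec (Fin n) n} → IsPerm v → (π : Permutation n n) →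
  (∀ q → lookup u q ≡ lookup v (π ⟨$⟩ʳ q)) → IsPerm u
IsPerm-rearrange {v = v} v-perm π u≗vπ k =
    π ⟨$⟩ˡ position v v-perm k
  , trans (u≗vπ _) (trans (cong (lookup v) (inverseʳ π)) (lookup-position v v-perm k))
  , λ q uq≡k → trans (sym (inverseˡ π))
                     (cong (π ⟨$⟩ˡ_) (position-unique v v-perm (trans (sym (u≗vπ q)) uq≡k)))

module _ {n} (v : Vec (Fin n) n) {a b : Fin n} where

  lookup-swapAt-left : a ≢ b → lookup (swapAt v a b) a ≡ lookup v b
  lookup-swapAt-left a≢b =
    trans (lookup∘update′ a≢b (v [ a ]≔ lookup v b) (lookup v a)) (lookup∘update a v (lookup v b))

  lookup-swapAt-right : lookup (swapAt v a b) b ≡ lookup v a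
  lookup-swapAt-right = lookup∘update b (v [ a ]≔ lookup v b) (lookup v a)

  lookup-swapAt-other : ∀ {q} → q ≢ a → q ≢ b → lookup (swapAt v a b) q ≡ lookup v q
  lookup-swapAt-other {q} q≢a q≢b =
    trans (lookup∘update′ q≢b (v [ a ]≔ lookup v b) (lookup v a)) (lookup∘update′ q≢a v (lookup v b))

  lookup-swapAt : a ≢ b → ∀ q → lookup (swapAt v a b) q ≡ lookup v (PC.transpose a b q)
  lookup-swapAt a≢b q with q ≟ a | q ≟ b
  ... | yes refl | _        = lookup-swapAt-left a≢b
  ... | no _     | yes refl rewrite dec-true (q ≟ q) refl = lookup-swapAt-right
  ... | no q≢a   | no q≢b   rewrite dec-false (q ≟ b) q≢b = lookup-swapAt-other q≢a q≢b

IsPerm-swapAt : ∀ {n} (v : Vec (Fin n) n) {a b} → IsPerm v → a ≢ b → IsPerm (swapAt v a b)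
IsPerm-swapAt v {a} {b} v-perm a≢b =
  IsPerm-rearrange {u = swapAt v a b} {v = v} v-perm (transpose a b) (lookup-swapAt v a≢b)

-- Inversion sequences as sums

smallerBefore smallerAfter : ∀ {n} → Vec (Fin n) n → Fin n → Fin n → ℕ
smallerBefore {n} v p k = ∑[ q < n ] 𝟙 ((q <? p) ×-dec (lookup v q <? k))
smallerAfter  {n} v p k = ∑[ q < n ] 𝟙 ((p <? q) ×-dec (lookup v q <? k))

smallerCount : ∀ {n} → Vec (Fin n) n → Fin n → ℕ
smallerCount {n} v k = ∑[ q < n ] 𝟙 (lookup v q <? k)

smallerCount-split : ∀ {n} (v : Vec (Fin n) n) p k →
  smallerCount v k ≡ smallerBefore v p k + (𝟙 (lookup v p <? k) + smallerAfter v p k)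
smallerCount-split v p k = ∑-split (λ q → lookup v q <? k) p

smallerAfter≤smallerCount : ∀ {n} (v : Vec (Fin n) n) p k → smallerAfter v p k ≤ℕ smallerCount v k
smallerAfter≤smallerCount v p k = ∑-mono-≤ (λ q → 𝟙-×-≤ (p <? q) (lookup v q <? k))

smallerCount-perm : ∀ {n} (v w : Vec (Fin n) n) → IsPerm v → IsPerm w → ∀ k →
  smallerCount v k ≡ smallerCount w k
smallerCount-perm v w v-perm w-perm k =
  trans (∑-∘lookup v v-perm (𝟙 ∘ (_<? k))) (sym (∑-∘lookup w w-perm (𝟙 ∘ (_<? k))))

invSeq-position : ∀ {n} (v : Vec (Fin n) n) → IsPerm v → ∀ {p k} → lookup v p ≡ k →
  invSeq v k ≡ smallerAfter v p k
invSeq-position {n} v v-perm {p} {k} vp≡k = begin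
  invSeq v k
    ≡⟨ length-filter-cartesianProduct (λ (r , q) → (lookup v r ≟ k) ×-dec later r q) ⟩
  ∑[ r < n ] ∑[ q < n ] 𝟙 ((lookup v r ≟ k) ×-dec later r q)
    ≡⟨ ∑-δ _ p (λ r r≢p → ∑-zero (λ q → 𝟙-×-no (lookup v r ≟ k) (later r q) (r≢p ∘ position-at))) ⟩
  ∑[ q < n ] 𝟙 ((lookup v p ≟ k) ×-dec later p q)
    ≡⟨ sum-cong-≗ (λ q → 𝟙-×-yes (lookup v p ≟ k) (later p q) vp≡k) ⟩
  smallerAfter v p k ∎
  where
  open ≡-Reasoning
  later : ∀ r q → Dec (r < q × lookup v q < k)
  later r q = (r <? q) ×-dec (lookup v q <? k)
  position-at : ∀ {r} → lookup v r ≡ k → r ≡ p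
  position-at vr≡k = lookup-injective v v-perm (trans vr≡k (sym vp≡k))

-- Middle steps

inversions : ∀ {n} → Vec (Fin n) n → ℕ
inversions {n} v = ∑[ k < n ] invSeq v k

record MiddleStep {n} (v : Vec (Fin n) n) (a p : Fin n) : Set where
  field
    a<p    : a < p
    ascent : lookup v a < lookup v p
    gap    : ∀ c → a < c → c < p → lookup v p < lookup v c

data Region {n} (a p : Fin n) : Fin n → Set where
  before  : ∀ {q} → q < a → Region a p q
  at-a    : Region a p a
  between : ∀ {q} → a < q → q < p → Region a p q
  at-p    : Region a p p
  after   : ∀ {q} → p < q → Region a p q

region : ∀ {n} {a p : Fin n} → a < p → ∀ q → Region a p q
region {a = a} {p} a<p q with <-cmp q a | <-cmp q p
... | tri< q<a _ _ | _            = before q<a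
... | tri≈ _ refl _ | _           = at-a
... | tri> _ _ a<q | tri< q<p _ _ = between a<q q<p
... | tri> _ _ _   | tri≈ _ refl _ = at-p
... | tri> _ _ _   | tri> _ _ p<q = after p<q

module SwapAtMiddleStep {n} {v : Vec (Fin n) n} {a p : Fin n} (v-perm : IsPerm v) (step : MiddleStep v a p)
  where
  open MiddleStep step

  a≢p : a ≢ p
  a≢p = <⇒≢ a<p

  v′ : Vec (Fin n) n
  v′ = swapAt v a p

  v′-perm : IsPerm v′
  v′-perm = IsPerm-swapAt v v-perm a≢p

  i j : Fin n
  i = lookup v p
  j = lookup v a

  lookup-v′ : ∀ {q} → q ≢ a → q ≢ p → lookup v′ q ≡ lookup v q
  lookup-v′ = lookup-swapAt-other v

  smallerAfter-at-a : smallerAfter v′ a i ≡ smallerAfter v p i + 1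
  smallerAfter-at-a = begin
    smallerAfter v′ a i
      ≡⟨ sum-cong-≗ pointwise ⟩
    ∑[ q < n ] (𝟙 ((p <? q) ×-dec (lookup v q <? i)) + 𝟙 (q ≟ p))
      ≡⟨ ∑-distrib-+ (λ q → 𝟙 ((p <? q) ×-dec (lookup v q <? i))) (λ q → 𝟙 (q ≟ p)) ⟩
    smallerAfter v p i + ∑[ q < n ] 𝟙 (q ≟ p)
      ≡⟨ cong (smallerAfter v p i +_) (∑-single p 1) ⟩
    smallerAfter v p i + 1
      ∎
    where
    open ≡-Reasoning
    pointwise : ∀ q →
      𝟙 ((a <? q) ×-dec (lookup v′ q <? i)) ≡ 𝟙 ((p <? q) ×-dec (lookup v q <? i)) + 𝟙 (q ≟ p)
    pointwise q with region a<p q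
    ... | before q<a rewrite dec-false (a <? q) (<-asym q<a) | dec-false (p <? q) (<-asym (<-trans q<a a<p))
                           | dec-false (q ≟ p) (<⇒≢ (<-trans q<a a<p)) = refl
    ... | at-a rewrite dec-false (a <? a) (<-irrefl refl) | dec-false (p <? a) (<-asym a<p)
                     | dec-false (a ≟ p) a≢p = refl
    ... | between a<q q<p rewrite lookup-v′ (<⇒≢ a<q ∘ sym) (<⇒≢ q<p) | dec-true (a <? q) a<q
                                | dec-false (lookup v q <? i) (<-asym (gap q a<q q<p))
                                | dec-false (p <? q) (<-asym q<p) | dec-false (q ≟ p) (<⇒≢ q<p) = refl
    ... | at-p rewrite lookup-swapAt-right v {a} {p} | dec-true (a <? p) a<p | dec-true (j <? i) ascent
                     | dec-false (p <? p) (<-irrefl refl) | dec-true (p ≟ p) refl = refl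
    ... | after p<q rewrite lookup-v′ (<⇒≢ (<-trans a<p p<q) ∘ sym) (<⇒≢ p<q ∘ sym)
                          | dec-true (a <? q) (<-trans a<p p<q) | dec-true (p <? q) p<q
                          | dec-false (q ≟ p) (<⇒≢ p<q ∘ sym) = sym (+-identityʳ _)

  smallerAfter-at-p : smallerAfter v′ p j ≡ smallerAfter v a j
  smallerAfter-at-p = sum-cong-≗ pointwise
    where
    pointwise : ∀ q → 𝟙 ((p <? q) ×-dec (lookup v′ q <? j)) ≡ 𝟙 ((a <? q) ×-dec (lookup v q <? j))
    pointwise q with region a<p q
    ... | before q<a rewrite dec-false (p <? q) (<-asym (<-trans q<a a<p))
                           | dec-false (a <? q) (<-asym q<a) = refl
    ... | at-a rewrite dec-false (p <? a) (<-asym a<p) | dec-false (a <? a) (<-irrefl refl) = refl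
    ... | between a<q q<p rewrite dec-false (p <? q) (<-asym q<p) | dec-true (a <? q) a<q
                                | dec-false (lookup v q <? j) (<-asym (<-trans ascent (gap q a<q q<p))) = refl
    ... | at-p rewrite dec-false (p <? p) (<-irrefl refl) | dec-true (a <? p) a<p
                     | dec-false (i <? j) (<-asym ascent) = refl
    ... | after p<q rewrite lookup-v′ (<⇒≢ (<-trans a<p p<q) ∘ sym) (<⇒≢ p<q ∘ sym)
                          | dec-true (p <? q) p<q | dec-true (a <? q) (<-trans a<p p<q) = refl

  smallerAfter-unmoved : ∀ {c} → c ≢ a → c ≢ p →
    smallerAfter v′ c (lookup v c) ≡ smallerAfter v c (lookup v c)
  smallerAfter-unmoved {c} c≢a c≢p = ∑-cong-except a≢p
    (λ q q≢a q≢p → cong (λ x → 𝟙 ((c <? q) ×-dec (x <? k))) (lookup-v′ q≢a q≢p)) ends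
    where
    k = lookup v c
    ends : 𝟙 ((c <? a) ×-dec (lookup v′ a <? k)) + 𝟙 ((c <? p) ×-dec (lookup v′ p <? k))
         ≡ 𝟙 ((c <? a) ×-dec (j <? k)) + 𝟙 ((c <? p) ×-dec (i <? k))
    ends rewrite lookup-swapAt-left v a≢p | lookup-swapAt-right v {a} {p} with region a<p c
    ... | before c<a rewrite dec-true (c <? a) c<a | dec-true (c <? p) (<-trans c<a a<p) =
      +-comm (𝟙 (i <? k)) (𝟙 (j <? k))
    ... | at-a = contradiction refl c≢a
    ... | between a<c c<p rewrite dec-false (c <? a) (<-asym a<c) | dec-true (c <? p) c<p
                                | dec-true (i <? k) (gap c a<c c<p)
                                | dec-true (j <? k) (<-trans ascent (gap c a<c c<p)) = refl
    ... | at-p = contradiction refl c≢p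
    ... | after p<c rewrite dec-false (c <? a) (<-asym (<-trans a<p p<c))
                          | dec-false (c <? p) (<-asym p<c) = refl

  invSeq-unmoved : ∀ {c} → c ≢ a → c ≢ p →
    invSeq v′ (lookup v c) ≡ invSeq v (lookup v c) + 𝟙 (lookup v c ≟ i)
  invSeq-unmoved {c} c≢a c≢p rewrite dec-false (lookup v c ≟ i) (c≢p ∘ lookup-injective v v-perm) =
    begin
    invSeq v′ (lookup v c)          ≡⟨ invSeq-position v′ v′-perm (lookup-v′ c≢a c≢p) ⟩
    smallerAfter v′ c (lookup v c)  ≡⟨ smallerAfter-unmoved c≢a c≢p ⟩
    smallerAfter v c (lookup v c)   ≡⟨ invSeq-position v v-perm refl ⟨
    invSeq v (lookup v c)           ≡⟨ +-identityʳ _ ⟨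
    invSeq v (lookup v c) + 0       ∎
    where open ≡-Reasoning

  invSeq-swapAt-position : ∀ c →
    invSeq v′ (lookup v c) ≡ invSeq v (lookup v c) + 𝟙 (lookup v c ≟ i)
  invSeq-swapAt-position c with region a<p c
  ... | before c<a       = invSeq-unmoved (<⇒≢ c<a) (<⇒≢ (<-trans c<a a<p))
  ... | between a<c c<p  = invSeq-unmoved (<⇒≢ a<c ∘ sym) (<⇒≢ c<p)
  ... | after p<c        = invSeq-unmoved (<⇒≢ (<-trans a<p p<c) ∘ sym) (<⇒≢ p<c ∘ sym)
  ... | at-a rewrite dec-false (j ≟ i) (a≢p ∘ lookup-injective v v-perm) = begin
    invSeq v′ j          ≡⟨ invSeq-position v′ v′-perm (lookup-swapAt-right v) ⟩
    smallerAfter v′ p j  ≡⟨ smallerAfter-at-p ⟩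
    smallerAfter v a j   ≡⟨ invSeq-position v v-perm refl ⟨
    invSeq v j           ≡⟨ +-identityʳ _ ⟨
    invSeq v j + 0       ∎
    where open ≡-Reasoning
  ... | at-p rewrite dec-true (i ≟ i) refl = begin
    invSeq v′ i              ≡⟨ invSeq-position v′ v′-perm (lookup-swapAt-left v a≢p) ⟩
    smallerAfter v′ a i      ≡⟨ smallerAfter-at-a ⟩
    smallerAfter v p i + 1   ≡⟨ cong (_+ 1) (invSeq-position v v-perm refl) ⟨
    invSeq v i + 1           ∎
    where open ≡-Reasoning

  invSeq-swapAt : ∀ k → invSeq v′ k ≡ invSeq v k + 𝟙 (k ≟ i)
  invSeq-swapAt k =
    subst (λ k → invSeq v′ k ≡ invSeq v k + 𝟙 (k ≟ i)) (lookup-position v v-perm k)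
          (invSeq-swapAt-position (position v v-perm k))

  v≤v′ : MiddleLe v v′
  v≤v′ k = subst (invSeq v k ≤ℕ_) (sym (invSeq-swapAt k)) (m≤m+n _ _)

  stays-below : ∀ {w} → MiddleLe v w → invSeq v i <ℕ invSeq w i → MiddleLe v′ w
  stays-below {w} v≤w vi<wi k rewrite invSeq-swapAt k with k ≟ i
  ... | yes refl = subst (_≤ℕ invSeq w i) (+-comm 1 (invSeq v i)) vi<wi
  ... | no _     = subst (_≤ℕ invSeq w k) (sym (+-identityʳ _)) (v≤w k)

  inversions-swapAt : inversions v′ ≡ suc (inversions v)
  inversions-swapAt = begin
    inversions v′                          ≡⟨ sum-cong-≗ invSeq-swapAt ⟩
    ∑[ k < n ] (invSeq v k + 𝟙 (k ≟ i))    ≡⟨ ∑-distrib-+ (invSeq v) (λ k → 𝟙 (k ≟ i)) ⟩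
    inversions v + ∑[ k < n ] 𝟙 (k ≟ i)    ≡⟨ cong (inversions v +_) (∑-single i 1) ⟩
    inversions v + 1                       ≡⟨ +-comm (inversions v) 1 ⟩
    suc (inversions v)                     ∎
    where open ≡-Reasoning

  bruhatStep : BruhatStep v v′
  bruhatStep = a , p , a<p , ascent , (λ c a<c c<p (_ , vc<vp) → <-asym vc<vp (gap c a<c c<p)) , refl

adjacent-middleStep : ∀ {n} {v : Vec (Fin n) n} {a b} → toℕ b ≡ suc (toℕ a) → lookup v a < lookup v b →
  MiddleStep v a b
adjacent-middleStep {a = a} {b} b≡1+a ascent = record
  { a<p    = subst (toℕ a <ℕ_) (sym b≡1+a) (n<1+n (toℕ a))
  ; ascent = ascent
  ; gap    = λ c a<c c<b → contradiction (s≤s⁻¹ (subst (toℕ c <ℕ_) b≡1+a c<b)) (<⇒≱ a<c)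
  }

weak⇒middle : ∀ {n} (v w : Vec (Fin n) n) → IsPerm v → WeakLe v w → MiddleLe v w
weak⇒middle v .v v-perm ε k = ≤-refl
weak⇒middle v w v-perm ((a , b , b≡1+a , ascent , refl) ◅ steps) k =
  ≤-trans (v≤v′ k) (weak⇒middle _ w v′-perm steps k)
  where open SwapAtMiddleStep v-perm (adjacent-middleStep {v = v} b≡1+a ascent)

-- From the middle order to the Bruhat order

closest-below : ∀ {n ℓ} {P : Pred (Fin n) ℓ} → Decidable P → ∀ {a p : Fin n} → a < p → P a →
  ∃ λ b → b < p × P b × (∀ c → b < c → c < p → ¬ P c)
closest-below {P = P} P? {a} {p} a<p Pa = search (>-wellFounded a) a<p Pa
  where
  search : ∀ {b} → Acc _>_ b → b < p → P b → ∃ λ b → b < p × P b × (∀ c → b < c → c < p → ¬ P c)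
  search {b} (acc closer) b<p Pb with any? (λ c → (b <? c) ×-dec ((c <? p) ×-dec P? c))
  ... | yes (c , b<c , c<p , Pc) = search (closer b<c) c<p Pc
  ... | no none                  = b , b<p , Pb , λ c b<c c<p Pc → none (c , b<c , c<p , Pc)

smaller-earlier : ∀ {n} (v w : Vec (Fin n) n) (v-perm : IsPerm v) → IsPerm w →
  ∀ {k} → invSeq v k <ℕ invSeq w k → ∃ λ a → a < position v v-perm k × lookup v a < k
smaller-earlier v w v-perm w-perm {k} vk<wk with any? (λ a → (a <? p) ×-dec (lookup v a <? k))
  where p = position v v-perm k
... | yes found = found
... | no none   = contradiction (begin
  invSeq w k                          ≡⟨ invSeq-position w w-perm (lookup-position w w-perm k) ⟩
  smallerAfter w _ k                  ≤⟨ smallerAfter≤smallerCount w _ k ⟩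
  smallerCount w k                    ≡⟨ smallerCount-perm w v w-perm v-perm k ⟩
  smallerCount v k                    ≡⟨ sum-cong-≗ only-after ⟩
  smallerAfter v p k                  ≡⟨ invSeq-position v v-perm vp≡k ⟨
  invSeq v k                          ∎) (<⇒≱ vk<wk)
  where
  open ℕ.≤-Reasoning
  p = position v v-perm k
  vp≡k = lookup-position v v-perm k
  only-after : ∀ q → 𝟙 (lookup v q <? k) ≡ 𝟙 ((p <? q) ×-dec (lookup v q <? k))
  only-after q with <-cmp q p
  ... | tri< q<p _ _ rewrite dec-false (lookup v q <? k) (λ vq<k → none (q , q<p , vq<k))
                           | dec-false (p <? q) (<-asym q<p) = refl
  ... | tri≈ _ refl _ rewrite dec-false (lookup v q <? k) (<-irrefl vp≡k)
                            | dec-false (q <? q) (<-irrefl refl) = refl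
  ... | tri> _ _ p<q rewrite dec-true (p <? q) p<q = refl

closest-smaller⇒middleStep : ∀ {n} (v : Vec (Fin n) n) → IsPerm v → ∀ {a p k} → lookup v p ≡ k →
  a < p → lookup v a < k → (∀ c → a < c → c < p → ¬ lookup v c < k) → MiddleStep v a p
closest-smaller⇒middleStep v v-perm {a} {p} {k} vp≡k a<p va<k closest = record
  { a<p    = a<p
  ; ascent = subst (lookup v a <_) (sym vp≡k) va<k
  ; gap    = λ c a<c c<p →
      subst (_< lookup v c) (sym vp≡k) (≤∧≢⇒< (≮⇒≥ (closest c a<c c<p)) (k≢ c<p))
  }
  where
  k≢ : ∀ {c} → c < p → k ≢ lookup v c
  k≢ c<p k≡vc = <⇒≢ c<p (lookup-injective v v-perm (trans (sym k≡vc) (sym vp≡k)))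

middleStep-toward : ∀ {n} (v w : Vec (Fin n) n) (v-perm : IsPerm v) → IsPerm w →
  ∀ {k} → invSeq v k <ℕ invSeq w k → ∃ λ a → MiddleStep v a (position v v-perm k)
middleStep-toward v w v-perm w-perm {k} vk<wk =
  let _ , a₀<p , va₀<k       = smaller-earlier v w v-perm w-perm vk<wk
      a , a<p , va<k , closest = closest-below (λ c → lookup v c <? k) a₀<p va₀<k
  in  a , closest-smaller⇒middleStep v v-perm (lookup-position v v-perm k) a<p va<k closest

invSeq-first-difference : ∀ {n} (v w : Vec (Fin n) n) → IsPerm v → IsPerm w → ∀ {p} →
  (∀ q → q < p → lookup v q ≡ lookup w q) → lookup v p < lookup w p →
  invSeq v (lookup w p) <ℕ invSeq w (lookup w p)
-- β = w(p) sits at p in w but strictly after p in v; comparing the counts of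
-- entries below β before, at and after p gives I(w)(β) = 1 + #{q > p : v(q) < β}.
invSeq-first-difference v w v-perm w-perm {p} agree vp<β = let open ℕ.≤-Reasoning in begin-strict
  invSeq v β                ≡⟨ invSeq-position v v-perm (lookup-position v v-perm β) ⟩
  smallerAfter v q₀ β
    ≤⟨ ∑-mono-≤ (λ q → 𝟙-×-mono (q₀ <? q) (p <? q) (lookup v q <? β) (<-trans p<q₀)) ⟩
  smallerAfter v p β        <⟨ n<1+n _ ⟩
  suc (smallerAfter v p β)  ≡⟨ +-cancelˡ-≡ (smallerBefore v p β) _ _ counts ⟩
  smallerAfter w p β        ≡⟨ invSeq-position w w-perm refl ⟨
  invSeq w β                ∎
  where
  β = lookup w p
  q₀ = position v v-perm β
  p<q₀ : p < q₀
  p<q₀ with <-cmp p q₀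
  ... | tri< p<q₀ _ _ = p<q₀
  ... | tri≈ _ p≡q₀ _ =
    contradiction vp<β (<-irrefl (trans (cong (lookup v) p≡q₀) (lookup-position v v-perm β)))
  ... | tri> _ _ q₀<p = contradiction
    (lookup-injective w w-perm (trans (sym (agree q₀ q₀<p)) (lookup-position v v-perm β))) (<⇒≢ q₀<p)
  same-before : smallerBefore v p β ≡ smallerBefore w p β
  same-before = sum-cong-≗ λ q → agree-before q (q <? p)
    where
    agree-before : ∀ q (q<?p : Dec (q < p)) →
      𝟙 (q<?p ×-dec (lookup v q <? β)) ≡ 𝟙 (q<?p ×-dec (lookup w q <? β))
    agree-before q (yes q<p) rewrite agree q q<p = refl
    agree-before q (no _)    = refl
  counts : smallerBefore v p β + suc (smallerAfter v p β) ≡ smallerBefore v p β + smallerAfter w p β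
  counts = let open ≡-Reasoning in begin
    smallerBefore v p β + (1 + smallerAfter v p β)
      ≡⟨ cong (λ m → smallerBefore v p β + (m + smallerAfter v p β)) (𝟙-yes (lookup v p <? β) vp<β) ⟨
    smallerBefore v p β + (𝟙 (lookup v p <? β) + smallerAfter v p β)
      ≡⟨ smallerCount-split v p β ⟨
    smallerCount v β
      ≡⟨ smallerCount-perm v w v-perm w-perm β ⟩
    smallerCount w β
      ≡⟨ smallerCount-split w p β ⟩
    smallerBefore w p β + (𝟙 (β <? β) + smallerAfter w p β)
      ≡⟨ cong₂ (λ b m → b + (m + smallerAfter w p β)) (sym same-before) (𝟙-no (β <? β) (<-irrefl refl)) ⟩
    smallerBefore v p β + smallerAfter w p β ∎

invSeq-injective : ∀ {n} (v w : Vec (Fin n) n) → IsPerm v → IsPerm w →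
  (∀ k → invSeq v k ≡ invSeq w k) → v ≡ w
invSeq-injective v w v-perm w-perm same = begin
  v                   ≡⟨ tabulate∘lookup v ⟨
  Vec.tabulate (lookup v) ≡⟨ tabulate-cong (λ p → agree p (<-wellFounded p)) ⟩
  Vec.tabulate (lookup w) ≡⟨ tabulate∘lookup w ⟩
  w                   ∎
  where
  open ≡-Reasoning
  agree : ∀ p → Acc _<_ p → lookup v p ≡ lookup w p
  agree p (acc earlier) with <-cmp (lookup v p) (lookup w p)
  ... | tri≈ _ vp≡wp _ = vp≡wp
  ... | tri< vp<wp _ _ = contradiction (same (lookup w p))
    (ℕ.<⇒≢ (invSeq-first-difference v w v-perm w-perm (λ q q<p → agree q (earlier q<p)) vp<wp))
  ... | tri> _ _ wp<vp = contradiction (sym (same (lookup v p)))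
    (ℕ.<⇒≢ (invSeq-first-difference w v w-perm v-perm (λ q q<p → sym (agree q (earlier q<p))) wp<vp))

module _ {n} (w : Vec (Fin n) n) (w-perm : IsPerm w) where

  -- The fuel d bounds the number of remaining steps, each of which adds one inversion.
  middle⇒bruhat : ∀ d (v : Vec (Fin n) n) → IsPerm v → MiddleLe v w → inversions w ≤ℕ d + inversions v →
    BruhatLe v w
  middle⇒bruhat d v v-perm v≤w bound with any? (λ k → invSeq v k ℕ.<? invSeq w k)
  ... | no none = subst (BruhatLe v) (invSeq-injective v w v-perm w-perm equal) ε
    where
    equal : ∀ k → invSeq v k ≡ invSeq w k
    equal k = ℕ.≤-antisym (v≤w k) (≮⇒≥ (λ vk<wk → none (k , vk<wk)))
  ... | yes (k , vk<wk) with middleStep-toward v w v-perm w-perm vk<wk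
  ...   | a , step = bruhatStep ◅ continue d bound
    where
    open SwapAtMiddleStep v-perm step
    v′≤w : MiddleLe v′ w
    v′≤w = stays-below {w = w} v≤w
      (subst (λ k → invSeq v k <ℕ invSeq w k) (sym (lookup-position v v-perm k)) vk<wk)
    continue : ∀ d → inversions w ≤ℕ d + inversions v → BruhatLe v′ w
    continue zero    bound = contradiction
      (subst (_≤ℕ inversions v) inversions-swapAt (≤-trans (∑-mono-≤ v′≤w) bound)) (ℕ.n≮n _)
    continue (suc d) bound = middle⇒bruhat d v′ v′-perm v′≤w
      (subst (inversions w ≤ℕ_) (trans (sym (+-suc d _)) (cong (d +_) (sym inversions-swapAt))) bound)

mainTheorem3 : (n : ℕ) → (v w : Vec (Fin n) n) → IsPerm v → IsPerm w →
    (WeakLe v w → MiddleLe v w) × (MiddleLe v w → BruhatLe v w)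
mainTheorem3 n v w v-perm w-perm =
  weak⇒middle v w v-perm , λ v≤w → middle⇒bruhat w w-perm (inversions w) v v-perm v≤w (m≤m+n _ _)
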